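{- In the block-tree matrix construction described in the context, the number of non-zero entries of the $(N+n_f)\times(n+n_f)$ matrix $\mathcal{A}$ is $O(N\log n+n\log^2 n)$.
   Context: Parameters: $n\le N$; $\mathbb{F}$ a finite field with $\max(n^6,N+n^2)\le|\mathbb{F}|=\operatorname{poly} n$; $B=\Theta(\log n)$ with $n/B$ a power of 2; $\Delta_1=c\sqrt{B\log n}$ for a large constant $c$; $h=\log(n/B)+1$; $\Delta_i=\Delta_1 2^{(i-1)/2}$ for $1\le i<h$ and $\Delta_h=0$. Build a complete binary tree of blocks with $n/B$ level-1 blocks (leaves); each level-$i$ block ($i>1$) is the parent of two level-$(i-1)$ blocks; the single level-$h$ block is the root. Rows: rows $1,\dots,N$ ("retrieval rows") are assigned to level-1 blocks by a $\operatorname{poly}\log n$-wise independent hash function $[N]\to[n/B]$; further "filler rows" indexed $N+1,\dots,N+n_f$ are assigned: each level-$i$ block with $1<i<h$ gets $2\Delta_{i-1}+\Delta_i$ filler rows, the root gets $2\Delta_{h-1}$ filler rows, and $n_f$ is the total. Columns ($n+n_f$ in total): each level-1 block has $B+\Delta_1$ supplementary columns, each level-$i$ block with $1<i<h$ has $2\Delta_i$ supplementary columns, the root has none; columns are ordered by the postorder of the block owning them, so each block's subtree owns a contiguous interval whose suffix is the block's supplementary columns. The non-zero columns of a block $u$ are the supplementary columns of $u$ and of its two direct children (for a level-1 block: its own columns). Sample nonzero $x_1,\dots,x_h\in\mathbb{F}$ uniformly. For each row $v$ lying in a block $u$ on level $i$ and each non-zero column $j$ of $u$, set $\mathcal{A}_{v,j}=x_i^{\,j}/(v+j)$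 (with $v,j$ viewed as field elements); all other entries are $0$. -}

module Defs where

open import Data.Nat using (ℕ; zero; suc; _+_; _*_; _∸_; _^_; _≤_; _<_; _≤ᵇ_; _<ᵇ_; _≡ᵇ_)
open import Data.Nat.Logarithm using (⌊log₂_⌋)
open import Data.Bool using (Bool; true; false; if_then_else_; _∧_; _∨_; not)
open import Data.Fin using (Fin; toℕ)
open import Data.List using (List; []; _∷_; map; concat; replicate; upTo; allFin; length; filter; zip; _++_)
open import Data.Nat.ListAction using (sum)
open import Data.Product using (_×_; _,_)
open import Relation.Nullary using (¬_; Dec; yes; no)
open import Relation.Nullary.Decidable using (¬?)
open import Relation.Binary.PropositionalEquality using (_≡_; _≢_)
open import Relation.Binary.Definitions using (DecidableEquality)
open import Algebra.Structures using (IsCommutativeRing)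
open import Function.Bundles using (_↔_)

-- A field is a
-- commutative ring (with propositional equality) with 0 ≢ 1 in which
-- every non-zero element has an inverse; _⁻¹ is total, its value at 0
-- is unconstrained.

record FiniteField : Set₁ where
  infixl 7 _*ᶠ_
  infixl 6 _+ᶠ_
  field
    Carrier  : Set
    _+ᶠ_ _*ᶠ_ : Carrier → Carrier → Carrier
    -ᶠ_      : Carrier → Carrier
    0# 1#    : Carrier
    _⁻¹      : Carrier → Carrier
    isCommutativeRing : IsCommutativeRing _≡_ _+ᶠ_ _*ᶠ_ -ᶠ_ 0# 1#
    0≢1      : 0# ≢ 1#
    inverseʳ : ∀ x → x ≢ 0# → x *ᶠ (x ⁻¹) ≡ 1#
    _≟_      : DecidableEquality Carrier
    size     : ℕ
    enum     : Fin size ↔ Carrier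

  ι : ℕ → Carrier
  ι zero    = 0#
  ι (suc k) = 1# +ᶠ ι k

  _^ᶠ_ : Carrier → ℕ → Carrier
  x ^ᶠ zero  = 1#
  x ^ᶠ suc k = x *ᶠ (x ^ᶠ k)

ceilSqrt : ℕ → ℕ
ceilSqrt m = go 0 (suc m)
  where
  go : ℕ → ℕ → ℕ
  go k zero       = k
  go k (suc fuel) = if m ≤ᵇ k * k then k else go (suc k) fuel

-- The block-tree matrix construction.
--   n, N, B as in the paper; m with B * 2^m = n (so n/B = 2^m and
--   h = log(n/B) + 1 = m + 1); c the constant in Δ₁ = c √(B log n);
--   x i = x_i ∈ F (levels i = 1..h); hash : [N] → [n/B].
-- Blocks are pairs (level i , index k) with 1 ≤ i ≤ h, k < 2^(h-i);
-- the children of (i , k) are (i-1 , 2k) and (i-1 , 2k+1).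

Block : Set
Block = ℕ × ℕ

module Construction (FF : FiniteField) (n N B m c : ℕ)
                    (x : ℕ → FiniteField.Carrier FF)
                    (hash : Fin N → Fin (2 ^ m)) where
  open FiniteField FF using (Carrier; 0#; _⁻¹; _≟_; ι; _^ᶠ_) renaming (_*ᶠ_ to _·_)

  L : ℕ
  L = ⌊log₂ n ⌋

  h : ℕ
  h = suc m

  -- Δ_i = ⌈ c √(B log n) 2^((i-1)/2) ⌉ = ⌈ √(c² B log n 2^(i-1)) ⌉ for 1 ≤ i < h,
  -- and Δ_h = 0.
  Δ : ℕ → ℕ
  Δ i = if (i ≡ᵇ 1) ∨ (i <ᵇ h) then ceilSqrt (c * c * B * L * 2 ^ (i ∸ 1)) else 0

  -- number of supplementary columns of a level-i block
  sup : ℕ → ℕ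
  sup zero          = 0
  sup (suc zero)    = B + Δ 1
  sup (suc (suc i)) = if suc (suc i) <ᵇ h then 2 * Δ (suc (suc i)) else 0

  -- number of filler rows of a level-i block
  fill : ℕ → ℕ
  fill zero          = 0
  fill (suc zero)    = 0
  fill (suc (suc i)) = if suc (suc i) <ᵇ h
                         then 2 * Δ (suc i) + Δ (suc (suc i))
                         else 2 * Δ (suc i)

  S : ℕ → ℕ
  S zero          = 0
  S (suc zero)    = sup 1
  S (suc (suc i)) = 2 * S (suc i) + sup (suc (suc i))

  -- Columns are numbered 0,1,2,… in postorder here (column index j = this + 1).
  -- The subtree of (i , k) owns [k * S i , (k+1) * S i), whose suffix of
  -- length sup i is the block's own supplementary columns.
  ownCol : Block → ℕ → Bool
  ownCol (i , k) col = (k * S i + (S i ∸ sup i) ≤ᵇ col) ∧ (col <ᵇ k * S i + S i)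

  nzCol : Block → ℕ → Bool
  nzCol (zero , k)    col = false
  nzCol (suc zero , k) col = ownCol (1 , k) col
  nzCol (suc (suc i) , k) col =
    ownCol (suc (suc i) , k) col ∨ ownCol (suc i , 2 * k) col ∨ ownCol (suc i , suc (2 * k)) col

  levelBlocks : ℕ → List Block
  levelBlocks i = map (λ k → (i , k)) (upTo (2 ^ (h ∸ i)))

  fillerBlocks : List Block
  fillerBlocks = concat (map (λ i → concat (map (λ u → replicate (fill i) u) (levelBlocks i)))
                             (map (λ t → 2 + t) (upTo m)))

  n_f : ℕ
  n_f = length fillerBlocks

  rowBlocks : List Block
  rowBlocks = map (λ r → (1 , toℕ (hash r))) (allFin N) ++ fillerBlocks

  numRows : ℕ
  numRows = N + n_f

  numCols : ℕ
  numCols = n + n_f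

  -- the entry A_{v,j} (rows and columns 1-based), for row v lying in block u
  entry : Block → ℕ → ℕ → Carrier
  entry (i , k) v j = if nzCol (i , k) (j ∸ 1) then (x i ^ᶠ j) · (ι (v + j) ⁻¹) else 0#

  rowNnz : ℕ × Block → ℕ
  rowNnz (v , u) = length (filter (λ j → ¬? (entry u v j ≟ 0#)) (map suc (upTo numCols)))

  nnz : ℕ
  nnz = sum (map rowNnz (zip (map suc (upTo numRows)) rowBlocks))

-- A row of a level-i block can only be non-zero in the supplementary columns of the block and of its two
-- children.
-- The N retrieval rows therefore contribute O(N log n). For the filler rows, B ≤ b₂ log n gives
-- Δ_i ≤ D 2^⌊i/2⌋ with D = (1 + c) b₂ log n, so each of the 2^(h-i) blocks of level i contributes
-- fill i · rowWidth i = O(D² 2^i) entries and the whole level O(D² 2^h) = O(log² n · 2^m).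
-- There are m ≤ log n ≤ b₁ B levels, and B 2^m = n.
{-# OPTIONS --safe #-}
module Submission where

open import Defs
open import Data.Nat using (ℕ; _+_; _*_; _^_; _≤_; _<_)
open import Data.Nat.Logarithm using (⌊log₂_⌋)
open import Data.Fin using (Fin)
open import Data.Product using (Σ; _×_)
open import Relation.Binary.PropositionalEquality using (_≡_; _≢_)

open import Data.Bool using (Bool; true; false; if_then_else_; _∧_; _∨_; T)
open import Data.Empty using (⊥-elim)
open import Data.Fin using (toℕ)
open import Data.List using (List; []; _∷_; _++_; [_]; map; concat; concatMap; replicate; zip; length; filter; upTo; allFin)
open import Data.List.Membership.Propositional using (_∈_)
open import Data.List.Membership.Propositional.Properties using (∈-map⁻; ∈-upTo⁻)
open import Data.List.Properties using (upTo-∷ʳ; map-++; map-∘; length-map; length-tabulate; length-upTo)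
open import Data.List.Relation.Unary.Any using (here; there)
open import Data.Nat using (zero; suc; _∸_; _⊓_; _≤ᵇ_; _<ᵇ_; _≡ᵇ_; z≤n; s≤s)
open import Data.Nat.ListAction using (sum)
open import Data.Nat.ListAction.Properties using (sum-++)
open import Data.Nat.Logarithm using (⌊log₂⌋-mono-≤; ⌊log₂[2^n]⌋≡n)
open import Data.Nat.Properties
open import Data.Nat.Tactic.RingSolver using (solve-∀)
open import Data.Product using (_,_)
open import Data.Sum using (inj₁; inj₂)
open import Data.Unit using (tt)
open import Function using (_∘_; id)
open import Level using (Level)
open import Relation.Binary.PropositionalEquality using (refl; sym; trans; cong; subst)
open import Relation.Nullary using (yes; no)
open import Relation.Unary using (Pred; Decidable)

-- ceilSqrt runs a search local to Defs that cannot be named from here. The metavariable search is solved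
-- to it by ceilSqrt-suc, whose unification problem becomes a pattern once 2 and suc m are abstracted.
mutual
  search : ℕ → ℕ → ℕ → ℕ
  search = _

  ceilSqrt-suc : ∀ m → ceilSqrt (suc m) ≡ (if m <ᵇ 1 then 1 else search (suc m) 2 m)
  ceilSqrt-suc m with 2 | suc m
  ... | _ | _ = refl

search-≤ : ∀ m k j fuel → m ≤ k * k → j ≤ k → search m j fuel ≤ k
search-≤ m k j zero       m≤k² j≤k = j≤k
search-≤ m k j (suc fuel) m≤k² j≤k with m ≤ᵇ j * j in eq
... | true  = j≤k
... | false = search-≤ m k (suc j) fuel m≤k² j<k
  where
  j<k : j < k
  j<k = ≰⇒> λ k≤j → subst T eq (≤⇒≤ᵇ (≤-trans m≤k² (*-mono-≤ k≤j k≤j)))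

ceilSqrt-≤ : ∀ {m k} → m ≤ k * k → ceilSqrt m ≤ k
ceilSqrt-≤ {m} {k} m≤k² = search-≤ m k 0 (suc m) m≤k² z≤n

if-≤ : ∀ b {x y z} → x ≤ z → y ≤ z → (if b then x else y) ≤ z
if-≤ true  x≤z y≤z = x≤z
if-≤ false x≤z y≤z = y≤z

m∸[m∸n]≤n : ∀ m n → m ∸ (m ∸ n) ≤ n
m∸[m∸n]≤n m n with ≤-total n m
... | inj₁ n≤m = ≤-reflexive (m∸[m∸n]≡n n≤m)
... | inj₂ m≤n = subst (_≤ n) (sym (cong (m ∸_) (m≤n⇒m∸n≡0 m≤n))) m≤n

+-*-≤ : ∀ a b x y → a * x + b * y ≤ (a + b) * (x + y)
+-*-≤ a b x y = ≤-trans (m≤m+n (a * x + b * y) (a * y + b * x)) (≤-reflexive (expand a b x y))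
  where
  expand : ∀ a b x y → a * x + b * y + (a * y + b * x) ≡ (a + b) * (x + y)
  expand = solve-∀

2^⌊_/2⌋ : ℕ → ℕ
2^⌊ zero /2⌋          = 1
2^⌊ suc zero /2⌋      = 1
2^⌊ suc (suc i) /2⌋   = 2 * 2^⌊ i /2⌋

2^⌊/2⌋-mono : ∀ i → 2^⌊ i /2⌋ ≤ 2^⌊ suc i /2⌋
2^⌊/2⌋-mono zero          = ≤-refl
2^⌊/2⌋-mono (suc zero)    = s≤s z≤n
2^⌊/2⌋-mono (suc (suc i)) = *-monoʳ-≤ 2 (2^⌊/2⌋-mono i)

private
  [2t]²≡2*[2*t²] : ∀ t → (2 * t) * (2 * t) ≡ 2 * (2 * (t * t))
  [2t]²≡2*[2*t²] = solve-∀

2^⌊i/2⌋²≤2^i : ∀ i → 2^⌊ i /2⌋ * 2^⌊ i /2⌋ ≤ 2 ^ i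
2^⌊i/2⌋²≤2^i zero          = ≤-refl
2^⌊i/2⌋²≤2^i (suc zero)    = s≤s z≤n
2^⌊i/2⌋²≤2^i (suc (suc i)) = begin
  (2 * 2^⌊ i /2⌋) * (2 * 2^⌊ i /2⌋)  ≡⟨ [2t]²≡2*[2*t²] 2^⌊ i /2⌋ ⟩
  2 * (2 * (2^⌊ i /2⌋ * 2^⌊ i /2⌋))  ≤⟨ *-monoʳ-≤ 2 (*-monoʳ-≤ 2 (2^⌊i/2⌋²≤2^i i)) ⟩
  2 ^ suc (suc i)                    ∎
  where open ≤-Reasoning

2^[i∸1]≤2^⌊i/2⌋² : ∀ i → 2 ^ (i ∸ 1) ≤ 2^⌊ i /2⌋ * 2^⌊ i /2⌋
2^[i∸1]≤2^⌊i/2⌋² zero          = ≤-refl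
2^[i∸1]≤2^⌊i/2⌋² (suc zero)    = ≤-refl
2^[i∸1]≤2^⌊i/2⌋² (suc (suc i)) = begin
  2 * 2 ^ i                          ≤⟨ *-monoʳ-≤ 2 (2^i≤2*2^[i∸1] i) ⟩
  2 * (2 * 2 ^ (i ∸ 1))              ≤⟨ *-monoʳ-≤ 2 (*-monoʳ-≤ 2 (2^[i∸1]≤2^⌊i/2⌋² i)) ⟩
  2 * (2 * (2^⌊ i /2⌋ * 2^⌊ i /2⌋))  ≡⟨ [2t]²≡2*[2*t²] 2^⌊ i /2⌋ ⟨
  (2 * 2^⌊ i /2⌋) * (2 * 2^⌊ i /2⌋)  ∎
  where
  open ≤-Reasoning
  2^i≤2*2^[i∸1] : ∀ i → 2 ^ i ≤ 2 * 2 ^ (i ∸ 1)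
  2^i≤2*2^[i∸1] zero    = s≤s z≤n
  2^i≤2*2^[i∸1] (suc i) = ≤-refl

count : {A : Set} → (A → Bool) → List A → ℕ
count p []       = 0
count p (x ∷ xs) = if p x then suc (count p xs) else count p xs

count-++ : {A : Set} (p : A → Bool) (xs ys : List A) → count p (xs ++ ys) ≡ count p xs + count p ys
count-++ p []       ys = refl
count-++ p (x ∷ xs) ys with p x
... | true  = cong suc (count-++ p xs ys)
... | false = count-++ p xs ys

count-false : {A : Set} (xs : List A) → count (λ _ → false) xs ≡ 0
count-false []       = refl
count-false (x ∷ xs) = count-false xs

count-map : {A B : Set} (p : B → Bool) (f : A → B) (xs : List A) → count p (map f xs) ≡ count (p ∘ f) xs
count-map p f []       = refl
count-map p f (x ∷ xs) with p (f x)
... | true  = cong suc (count-map p f xs)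
... | false = count-map p f xs

length-filter-≤-count : {A : Set} {ℓ : Level} {P : Pred A ℓ} (P? : Decidable P) (p : A → Bool) →
                        (∀ {x} → P x → T (p x)) → ∀ xs → length (filter P? xs) ≤ count p xs
length-filter-≤-count P? p P⇒p []       = z≤n
length-filter-≤-count P? p P⇒p (x ∷ xs) with P? x | p x in px
... | yes Px | true  = s≤s (length-filter-≤-count P? p P⇒p xs)
... | yes Px | false = ⊥-elim (subst T px (P⇒p Px))
... | no _   | true  = m≤n⇒m≤1+n (length-filter-≤-count P? p P⇒p xs)
... | no _   | false = length-filter-≤-count P? p P⇒p xs

count-∨ : {A : Set} (p q : A → Bool) (xs : List A) → count (λ x → p x ∨ q x) xs ≤ count p xs + count q xs
count-∨ p q []       = z≤n
count-∨ p q (x ∷ xs) with p x | q x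
... | true  | true  = s≤s (≤-trans (count-∨ p q xs) (≤-trans (n≤1+n _) (≤-reflexive (sym (+-suc _ _)))))
... | true  | false = s≤s (count-∨ p q xs)
... | false | true  = ≤-trans (s≤s (count-∨ p q xs)) (≤-reflexive (sym (+-suc _ _)))
... | false | false = count-∨ p q xs

count-interval-upTo : ∀ a b M → count (λ j → (a ≤ᵇ j) ∧ (j <ᵇ b)) (upTo M) ≤ b ∸ a
count-interval-upTo a b M = ≤-trans (count-≤ M) (∸-monoˡ-≤ a (m⊓n≤n M b))
  where
  inside? : ℕ → Bool
  inside? j = (a ≤ᵇ j) ∧ (j <ᵇ b)

  unchanged : ∀ M → count inside? (upTo M) ≤ (M ⊓ b) ∸ a → count inside? (upTo M) + 0 ≤ (suc M ⊓ b) ∸ a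
  unchanged M ih = ≤-trans (≤-reflexive (+-identityʳ _)) (≤-trans ih (∸-monoˡ-≤ a (⊓-monoˡ-≤ b (n≤1+n M))))

  last-≤ : ∀ M → count inside? (upTo M) ≤ (M ⊓ b) ∸ a →
           count inside? (upTo M) + count inside? [ M ] ≤ (suc M ⊓ b) ∸ a
  last-≤ M ih with a ≤ᵇ M in a≤M | M <ᵇ b in M<b
  ... | true | true = begin
    count inside? (upTo M) + 1 ≤⟨ +-monoˡ-≤ 1 ih ⟩
    (M ⊓ b) ∸ a + 1            ≡⟨ cong (λ t → t ∸ a + 1) (m≤n⇒m⊓n≡m (<⇒≤ M<b′)) ⟩
    M ∸ a + 1                  ≡⟨ +-∸-comm 1 (≤ᵇ⇒≤ a M (subst T (sym a≤M) tt)) ⟨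
    M + 1 ∸ a                  ≡⟨ cong (_∸ a) (+-comm M 1) ⟩
    suc M ∸ a                  ≡⟨ cong (_∸ a) (m≤n⇒m⊓n≡m M<b′) ⟨
    (suc M ⊓ b) ∸ a            ∎
    where
    open ≤-Reasoning
    M<b′ : M < b
    M<b′ = <ᵇ⇒< M b (subst T (sym M<b) tt)
  ... | true  | false = unchanged M ih
  ... | false | _     = unchanged M ih

  -- [a, b) ∩ [0, M) has (M ⊓ b) ∸ a elements; this invariant survives appending M to upTo M.
  count-≤ : ∀ M → count inside? (upTo M) ≤ (M ⊓ b) ∸ a
  count-≤ zero    = z≤n
  count-≤ (suc M) = begin
    count inside? (upTo (suc M))                      ≡⟨ cong (count inside?) (upTo-∷ʳ M) ⟨
    count inside? (upTo M ++ [ M ])                   ≡⟨ count-++ inside? (upTo M) [ M ] ⟩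
    count inside? (upTo M) + count inside? [ M ]      ≤⟨ last-≤ M (count-≤ M) ⟩
    (suc M ⊓ b) ∸ a                                   ∎
    where open ≤-Reasoning

module _ {A : Set} (f : A → ℕ) where

  sum-map-++ : ∀ xs ys → sum (map f (xs ++ ys)) ≡ sum (map f xs) + sum (map f ys)
  sum-map-++ xs ys = trans (cong sum (map-++ f xs ys)) (sum-++ (map f xs) (map f ys))

  sum-map-concat : ∀ xss → sum (map f (concat xss)) ≡ sum (map (sum ∘ map f) xss)
  sum-map-concat []         = refl
  sum-map-concat (xs ∷ xss) = trans (sum-map-++ xs (concat xss)) (cong (sum (map f xs) +_) (sum-map-concat xss))

  sum-map-replicate : ∀ r x → sum (map f (replicate r x)) ≡ r * f x
  sum-map-replicate zero    x = refl
  sum-map-replicate (suc r) x = cong (f x +_) (sum-map-replicate r x)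

sum-map-≤ : {A : Set} (f : A → ℕ) {C : ℕ} (xs : List A) → (∀ {x} → x ∈ xs → f x ≤ C) →
            sum (map f xs) ≤ length xs * C
sum-map-≤ f []       f≤C = z≤n
sum-map-≤ f (x ∷ xs) f≤C = +-mono-≤ (f≤C (here refl)) (sum-map-≤ f xs (f≤C ∘ there))

sum-map-concatMap-≤ : {A B : Set} (f : A → ℕ) {C : ℕ} (F : B → List A) (xs : List B) →
                      (∀ {x} → x ∈ xs → sum (map f (F x)) ≤ C) →
                      sum (map f (concatMap F xs)) ≤ length xs * C
sum-map-concatMap-≤ f F xs bound = begin
  sum (map f (concat (map F xs)))     ≡⟨ sum-map-concat f (map F xs) ⟩
  sum (map (sum ∘ map f) (map F xs))  ≡⟨ cong sum (map-∘ xs) ⟨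
  sum (map (sum ∘ map f ∘ F) xs)      ≤⟨ sum-map-≤ (sum ∘ map f ∘ F) xs bound ⟩
  length xs * _                       ∎
  where open ≤-Reasoning

sum-map-zip-≤ : {A B : Set} (f : A × B → ℕ) (g : B → ℕ) → (∀ a b → f (a , b) ≤ g b) →
                ∀ as bs → sum (map f (zip as bs)) ≤ sum (map g bs)
sum-map-zip-≤ f g f≤g []       bs       = z≤n
sum-map-zip-≤ f g f≤g (a ∷ as) []       = z≤n
sum-map-zip-≤ f g f≤g (a ∷ as) (b ∷ bs) = +-mono-≤ (f≤g a b) (sum-map-zip-≤ f g f≤g as bs)

module NonZeroCount (FF : FiniteField) (n N B m c : ℕ) (x : ℕ → FiniteField.Carrier FF)
                    (hash : Fin N → Fin (2 ^ m)) where
  open Construction FF n N B m c x hash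
  open FiniteField FF using (0#)

  rowWidth : ℕ → ℕ
  rowWidth zero          = 0
  rowWidth (suc zero)    = sup 1
  rowWidth (suc (suc i)) = sup (suc (suc i)) + (sup (suc i) + sup (suc i))

  blockWidth : Block → ℕ
  blockWidth (i , _) = rowWidth i

  ownCol-count : ∀ i k M → count (ownCol (i , k)) (upTo M) ≤ sup i
  ownCol-count i k M = begin
    count (ownCol (i , k)) (upTo M)               ≤⟨ count-interval-upTo (k * S i + (S i ∸ sup i)) (k * S i + S i) M ⟩
    (k * S i + S i) ∸ (k * S i + (S i ∸ sup i))   ≡⟨ [m+n]∸[m+o]≡n∸o (k * S i) (S i) (S i ∸ sup i) ⟩
    S i ∸ (S i ∸ sup i)                           ≤⟨ m∸[m∸n]≤n (S i) (sup i) ⟩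
    sup i                                         ∎
    where open ≤-Reasoning

  nzCol-count : ∀ i k M → count (nzCol (i , k)) (upTo M) ≤ rowWidth i
  nzCol-count zero          k M = ≤-reflexive (count-false (upTo M))
  nzCol-count (suc zero)    k M = ownCol-count 1 k M
  nzCol-count (suc (suc i)) k M = begin
    count (λ j → own j ∨ left j ∨ right j) cols             ≤⟨ count-∨ own _ cols ⟩
    count own cols + count (λ j → left j ∨ right j) cols    ≤⟨ +-monoʳ-≤ (count own cols) (count-∨ left right cols) ⟩
    count own cols + (count left cols + count right cols)   ≤⟨ +-mono-≤ (ownCol-count (suc (suc i)) k M)
                                                                 (+-mono-≤ (ownCol-count (suc i) (2 * k) M)
                                                                           (ownCol-count (suc i) (suc (2 * k)) M)) ⟩
    rowWidth (suc (suc i))                                  ∎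
    where
    open ≤-Reasoning
    cols : List ℕ
    cols = upTo M
    own left right : ℕ → Bool
    own   = ownCol (suc (suc i) , k)
    left  = ownCol (suc i , 2 * k)
    right = ownCol (suc i , suc (2 * k))

  entry≢0⇒nzCol : ∀ u v j → entry u v j ≢ 0# → T (nzCol u (j ∸ 1))
  entry≢0⇒nzCol u v j entry≢0 with nzCol u (j ∸ 1)
  ... | true  = tt
  ... | false = ⊥-elim (entry≢0 refl)

  rowNnz-≤ : ∀ v u → rowNnz (v , u) ≤ blockWidth u
  rowNnz-≤ v (i , k) = begin
    rowNnz (v , (i , k))
      ≤⟨ length-filter-≤-count _ (λ j → nzCol (i , k) (j ∸ 1)) (entry≢0⇒nzCol (i , k) v _) (map suc (upTo numCols)) ⟩
    count (λ j → nzCol (i , k) (j ∸ 1)) (map suc (upTo numCols))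
      ≡⟨ count-map (λ j → nzCol (i , k) (j ∸ 1)) suc (upTo numCols) ⟩
    count (nzCol (i , k)) (upTo numCols)
      ≤⟨ nzCol-count i k numCols ⟩
    rowWidth i
      ∎
    where open ≤-Reasoning

  levelRows-cost : ∀ i → sum (map blockWidth (concatMap (replicate (fill i)) (levelBlocks i)))
                         ≤ 2 ^ (h ∸ i) * (fill i * rowWidth i)
  levelRows-cost i = begin
    sum (map blockWidth (concatMap (replicate (fill i)) (levelBlocks i)))
      ≤⟨ sum-map-concatMap-≤ blockWidth (replicate (fill i)) (levelBlocks i) replicated-cost ⟩
    length (levelBlocks i) * (fill i * rowWidth i)
      ≡⟨ cong (_* (fill i * rowWidth i)) (trans (length-map _ (upTo (2 ^ (h ∸ i)))) (length-upTo (2 ^ (h ∸ i)))) ⟩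
    2 ^ (h ∸ i) * (fill i * rowWidth i)
      ∎
    where
    open ≤-Reasoning
    replicated-cost : ∀ {u} → u ∈ levelBlocks i → sum (map blockWidth (replicate (fill i) u)) ≤ fill i * rowWidth i
    replicated-cost u∈ with ∈-map⁻ (λ k → (i , k)) u∈
    ... | k , _ , refl = ≤-reflexive (sum-map-replicate blockWidth (fill i) (i , k))

  nnz-≤ : ∀ {C} → (∀ {i} → i ≤ h → 2 ^ (h ∸ i) * (fill i * rowWidth i) ≤ C) → nnz ≤ N * rowWidth 1 + m * C
  nnz-≤ {C} level-≤ = begin
    nnz
      ≤⟨ sum-map-zip-≤ rowNnz blockWidth rowNnz-≤ (map suc (upTo numRows)) rowBlocks ⟩
    sum (map blockWidth rowBlocks)
      ≡⟨ sum-map-++ blockWidth retrievalBlocks fillerBlocks ⟩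
    sum (map blockWidth retrievalBlocks) + sum (map blockWidth fillerBlocks)
      ≤⟨ +-mono-≤ retrieval-cost filler-cost ⟩
    N * rowWidth 1 + m * C
      ∎
    where
    open ≤-Reasoning
    retrievalBlocks : List Block
    retrievalBlocks = map (λ r → (1 , toℕ (hash r))) (allFin N)

    leaf-width : ∀ {u} → u ∈ retrievalBlocks → blockWidth u ≤ rowWidth 1
    leaf-width u∈ with ∈-map⁻ _ u∈
    ... | _ , _ , refl = ≤-refl

    retrieval-cost : sum (map blockWidth retrievalBlocks) ≤ N * rowWidth 1
    retrieval-cost = ≤-trans (sum-map-≤ blockWidth retrievalBlocks leaf-width)
                             (≤-reflexive (cong (_* rowWidth 1) (trans (length-map _ (allFin N)) (length-tabulate {n = N} id))))

    filler-cost : sum (map blockWidth fillerBlocks) ≤ m * C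
    filler-cost = ≤-trans (sum-map-concatMap-≤ blockWidth _ levels level-cost)
                          (≤-reflexive (cong (_* C) (trans (length-map _ (upTo m)) (length-upTo m))))
      where
      levels : List ℕ
      levels = map (2 +_) (upTo m)
      level-cost : ∀ {i} → i ∈ levels → sum (map blockWidth (concatMap (replicate (fill i)) (levelBlocks i))) ≤ C
      level-cost i∈ with ∈-map⁻ (2 +_) i∈
      ... | t , t∈ , refl = ≤-trans (levelRows-cost (2 + t)) (level-≤ (s≤s (∈-upTo⁻ t∈)))

  module _ (b₂ : ℕ) (B≤b₂L : B ≤ b₂ * L) where

    -- D ≥ B, and D² ≥ c² B L because B ≤ b₂ L ≤ b₂² L; hence D 2^⌊i/2⌋ bounds Δ i, ceiling included.
    D : ℕ
    D = suc c * b₂ * L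

    Δ-≤ : ∀ i → Δ i ≤ D * 2^⌊ i /2⌋
    Δ-≤ i = if-≤ ((i ≡ᵇ 1) ∨ (i <ᵇ h)) (ceilSqrt-≤ (begin
      c * c * B * L * 2 ^ (i ∸ 1)          ≤⟨ *-mono-≤ (*-monoˡ-≤ L (*-monoʳ-≤ (c * c) B≤b₂²L)) (2^[i∸1]≤2^⌊i/2⌋² i) ⟩
      c * c * (b₂ * b₂ * L) * L * (t * t)  ≡⟨ square c b₂ L t ⟩
      (c * b₂ * L * t) * (c * b₂ * L * t)  ≤⟨ *-mono-≤ cb₂Lt≤Dt cb₂Lt≤Dt ⟩
      (D * t) * (D * t)                    ∎)) z≤n
      where
      open ≤-Reasoning
      t : ℕ
      t = 2^⌊ i /2⌋
      B≤b₂²L : B ≤ b₂ * b₂ * L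
      B≤b₂²L = ≤-trans B≤b₂L (*-monoˡ-≤ L (m≤m*m b₂))
        where
        m≤m*m : ∀ m → m ≤ m * m
        m≤m*m zero    = z≤n
        m≤m*m (suc m) = m≤m*n (suc m) (suc m)
      cb₂Lt≤Dt : c * b₂ * L * t ≤ D * t
      cb₂Lt≤Dt = *-monoˡ-≤ t (*-monoˡ-≤ L (m≤n+m (c * b₂) b₂))
      square : ∀ c b L t → c * c * (b * b * L) * L * (t * t) ≡ (c * b * L * t) * (c * b * L * t)
      square = solve-∀

    Δ-≤-next : ∀ i → Δ i ≤ D * 2^⌊ suc i /2⌋
    Δ-≤-next i = ≤-trans (Δ-≤ i) (*-monoʳ-≤ D (2^⌊/2⌋-mono i))

    sup-≤ : ∀ i → sup i ≤ 2 * (D * 2^⌊ i /2⌋)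
    sup-≤ zero    = z≤n
    sup-≤ (suc zero) = begin
      B + Δ 1          ≤⟨ +-mono-≤ B≤D*1 (Δ-≤ 1) ⟩
      D * 1 + D * 1    ≡⟨ cong (D * 1 +_) (+-identityʳ (D * 1)) ⟨
      2 * (D * 1)      ∎
      where
      open ≤-Reasoning
      B≤D*1 : B ≤ D * 1
      B≤D*1 = ≤-trans B≤b₂L (≤-trans (*-monoˡ-≤ L (m≤m+n b₂ (c * b₂))) (≤-reflexive (sym (*-identityʳ D))))
    sup-≤ (suc (suc i)) = if-≤ (suc (suc i) <ᵇ h) (*-monoʳ-≤ 2 (Δ-≤ (suc (suc i)))) z≤n

    fill-≤ : ∀ i → fill i ≤ 3 * (D * 2^⌊ i /2⌋)
    fill-≤ zero          = z≤n
    fill-≤ (suc zero)    = z≤n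
    fill-≤ (suc (suc i)) = if-≤ (suc (suc i) <ᵇ h)
      (≤-trans (+-mono-≤ children-≤ (Δ-≤ (suc (suc i)))) (≤-reflexive (2u+u≡3u (D * 2^⌊ suc (suc i) /2⌋))))
      (≤-trans children-≤ (*-monoˡ-≤ (D * 2^⌊ suc (suc i) /2⌋) (m≤m+n 2 1)))
      where
      children-≤ : 2 * Δ (suc i) ≤ 2 * (D * 2^⌊ suc (suc i) /2⌋)
      children-≤ = *-monoʳ-≤ 2 (Δ-≤-next (suc i))
      2u+u≡3u : ∀ u → 2 * u + u ≡ 3 * u
      2u+u≡3u = solve-∀

    rowWidth-≤ : ∀ i → rowWidth i ≤ 6 * (D * 2^⌊ i /2⌋)
    rowWidth-≤ zero          = z≤n
    rowWidth-≤ (suc zero)    = ≤-trans (sup-≤ 1) (*-monoˡ-≤ (D * 1) (m≤m+n 2 4))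
    rowWidth-≤ (suc (suc i)) =
      ≤-trans (+-mono-≤ (sup-≤ (suc (suc i))) (+-mono-≤ child-≤ child-≤)) (≤-reflexive (2u+[2u+2u]≡6u (D * 2^⌊ suc (suc i) /2⌋)))
      where
      child-≤ : sup (suc i) ≤ 2 * (D * 2^⌊ suc (suc i) /2⌋)
      child-≤ = ≤-trans (sup-≤ (suc i)) (*-monoʳ-≤ 2 (*-monoʳ-≤ D (2^⌊/2⌋-mono (suc i))))
      2u+[2u+2u]≡6u : ∀ u → 2 * u + (2 * u + 2 * u) ≡ 6 * u
      2u+[2u+2u]≡6u = solve-∀

    fill*rowWidth-≤ : ∀ i → fill i * rowWidth i ≤ 18 * (D * D) * 2 ^ i
    fill*rowWidth-≤ i = begin
      fill i * rowWidth i                        ≤⟨ *-mono-≤ (fill-≤ i) (rowWidth-≤ i) ⟩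
      3 * (D * t) * (6 * (D * t))             ≡⟨ regroup D t ⟩
      18 * (D * D) * (t * t)                  ≤⟨ *-monoʳ-≤ (18 * (D * D)) (2^⌊i/2⌋²≤2^i i) ⟩
      18 * (D * D) * 2 ^ i                    ∎
      where
      open ≤-Reasoning
      t : ℕ
      t = 2^⌊ i /2⌋
      regroup : ∀ D t → 3 * (D * t) * (6 * (D * t)) ≡ 18 * (D * D) * (t * t)
      regroup = solve-∀

    level-≤ : ∀ {i} → i ≤ h → 2 ^ (h ∸ i) * (fill i * rowWidth i) ≤ 18 * (D * D) * 2 ^ h
    level-≤ {i} i≤h = begin
      2 ^ (h ∸ i) * (fill i * rowWidth i)        ≤⟨ *-monoʳ-≤ (2 ^ (h ∸ i)) (fill*rowWidth-≤ i) ⟩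
      2 ^ (h ∸ i) * (18 * (D * D) * 2 ^ i)    ≡⟨ x*[y*z]≡y*[x*z] (2 ^ (h ∸ i)) (18 * (D * D)) (2 ^ i) ⟩
      18 * (D * D) * (2 ^ (h ∸ i) * 2 ^ i)    ≡⟨ cong (18 * (D * D) *_) (^-distribˡ-+-* 2 (h ∸ i) i) ⟨
      18 * (D * D) * 2 ^ (h ∸ i + i)          ≡⟨ cong (λ e → 18 * (D * D) * 2 ^ e) (m∸n+n≡m i≤h) ⟩
      18 * (D * D) * 2 ^ h                    ∎
      where
      open ≤-Reasoning
      x*[y*z]≡y*[x*z] : ∀ x y z → x * (y * z) ≡ y * (x * z)
      x*[y*z]≡y*[x*z] = solve-∀

    nnz-≤-log : nnz ≤ 6 * (suc c * b₂) * (N * L) + 36 * (suc c * b₂ * (suc c * b₂)) * (L * L * (m * 2 ^ m))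
    nnz-≤-log = begin
      nnz                                                    ≤⟨ nnz-≤ level-≤ ⟩
      N * rowWidth 1 + m * (18 * (D * D) * 2 ^ h)            ≤⟨ +-monoˡ-≤ _ (*-monoʳ-≤ N (rowWidth-≤ 1)) ⟩
      N * (6 * (D * 1)) + m * (18 * (D * D) * 2 ^ h)         ≡⟨ regroup (suc c * b₂) L N m (2 ^ m) ⟩
      6 * (suc c * b₂) * (N * L) + 36 * (suc c * b₂ * (suc c * b₂)) * (L * L * (m * 2 ^ m)) ∎
      where
      open ≤-Reasoning
      regroup : ∀ E L N m p → N * (6 * (E * L * 1)) + m * (18 * (E * L * (E * L)) * (2 * p))
                            ≡ 6 * E * (N * L) + 36 * (E * E) * (L * L * (m * p))
      regroup = solve-∀

log²*m*2^m≤log²*b₁*n : ∀ {n} B m b₁ → ⌊log₂ n ⌋ ≤ b₁ * B → B * 2 ^ m ≡ n →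
                       ⌊log₂ n ⌋ * ⌊log₂ n ⌋ * (m * 2 ^ m) ≤ ⌊log₂ n ⌋ * ⌊log₂ n ⌋ * (b₁ * n)
log²*m*2^m≤log²*b₁*n zero    m b₁ L≤b₁B refl = z≤n
log²*m*2^m≤log²*b₁*n (suc B) m b₁ L≤b₁B refl = *-monoʳ-≤ (L * L) (begin
  m * 2 ^ m               ≤⟨ *-monoˡ-≤ (2 ^ m) (≤-trans m≤L L≤b₁B) ⟩
  b₁ * suc B * 2 ^ m      ≡⟨ *-assoc b₁ (suc B) (2 ^ m) ⟩
  b₁ * (suc B * 2 ^ m)    ∎)
  where
  open ≤-Reasoning
  L : ℕ
  L = ⌊log₂ suc B * 2 ^ m ⌋
  m≤L : m ≤ L
  m≤L = subst (_≤ L) (⌊log₂[2^n]⌋≡n m) (⌊log₂⌋-mono-≤ (m≤n*m (2 ^ m) (suc B)))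

claim5p3 : (c b₁ b₂ e : ℕ) →
    Σ ℕ λ K →
      (n N B m : ℕ) →
      n ≤ N →
      ⌊log₂ n ⌋ ≤ b₁ * B → B ≤ b₂ * ⌊log₂ n ⌋ →
      B * 2 ^ m ≡ n →
      (FF : FiniteField) →
      n ^ 6 ≤ FiniteField.size FF → N + n ^ 2 ≤ FiniteField.size FF →
      FiniteField.size FF ≤ n ^ e →
      (x : ℕ → FiniteField.Carrier FF) →
      (∀ i → 1 ≤ i → i ≤ m + 1 → x i ≢ FiniteField.0# FF) →
      (hash : Fin N → Fin (2 ^ m)) →
      Construction.nnz FF n N B m c x hash
        ≤ K * (N * ⌊log₂ n ⌋ + n * (⌊log₂ n ⌋ * ⌊log₂ n ⌋))
claim5p3 c b₁ b₂ e = 6 * E + 36 * (E * E) * b₁ , λ n N B m _ L≤b₁B B≤b₂L B*2^m≡n FF _ _ _ x _ hash →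
  let open Construction FF n N B m c x hash using (nnz; L)
      open NonZeroCount FF n N B m c x hash
      open ≤-Reasoning
  in begin
    nnz                                                      ≤⟨ nnz-≤-log b₂ B≤b₂L ⟩
    6 * E * (N * L) + 36 * (E * E) * (L * L * (m * 2 ^ m))   ≤⟨ +-monoʳ-≤ (6 * E * (N * L))
                                                                  (*-monoʳ-≤ (36 * (E * E)) (log²*m*2^m≤log²*b₁*n B m b₁ L≤b₁B B*2^m≡n)) ⟩
    6 * E * (N * L) + 36 * (E * E) * (L * L * (b₁ * n))      ≡⟨ cong (6 * E * (N * L) +_) (regroup (36 * (E * E)) L b₁ n) ⟩
    6 * E * (N * L) + 36 * (E * E) * b₁ * (n * (L * L))      ≤⟨ +-*-≤ (6 * E) (36 * (E * E) * b₁) (N * L) (n * (L * L)) ⟩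
    (6 * E + 36 * (E * E) * b₁) * (N * L + n * (L * L))      ∎
  where
  E : ℕ
  E = suc c * b₂
  regroup : ∀ a L b n → a * (L * L * (b * n)) ≡ a * b * (n * (L * L))
  regroup = solve-∀
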